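{- Let $G=(V,E)$ be a DAG with integer netflow vector $\alpha$ and let $(\hat G,\hat\alpha)$ be an augmentation of $(G,\alpha)$. Then the restriction map $F\mapsto F|_E$ is an integral equivalence from $\mathcal F_{\hat G}(\hat\alpha)$ to $\mathcal F_G(\alpha)$.
   Context: All graphs are finite; $t(e),h(e)$ are tail and head. For a DAG $G=(V,E)$ and $\beta\in\mathbb Z^V$, $\mathcal F_G(\beta)\subseteq\mathbb R^E$ is the polytope of $F:E\to\mathbb R_{\ge0}$ with (outflow minus inflow) at $i$ equal to $\beta_i$ for every vertex $i$. $S_\alpha=\sum_{\alpha_i>0}\alpha_i$. Augmentation of $(G,\alpha)$: $(\hat G,\hat\alpha)$ with $\hat V=V\sqcup V_X\sqcup V_Y$, $\hat E=E\sqcup E_X\sqcup E_Y$, where $E_X$ is a set of $S_\alpha$ edges from $V_X$ to $\{i\in V:\alpha_i>0\}$ with exactly $\alpha_i$ of them having head $i$; $E_Y$ is a set of edges with tails in $\{i\in V:\alpha_i<0\}$ and heads in $V_Y$, with between $1$ and $|\alpha_i|$ of them having tail $i$; each vertex of $V_X$ (resp. $V_Y$) is incident to exactly one edge, lying in $E_X$ (resp. $E_Y$); $\hat\alpha$ is $0$ on $V$, $1$ on $V_X$, negative on $V_Y$, with $\alpha_i=\sum_{y\in E_Y,t(y)=i}\hat\alpha_{h(y)}$ whenever $\alpha_i<0$. Integer polytopes $P\subseteq\mathbb R^n$, $Q\subseteq\mathbb R^m$ are integrally equivalent via an affine map $\phi:\mathbb R^n\to\mathbb R^m$ if $\phi$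 restricts to a bijection $P\to Q$ and to a bijection $\mathbb Z^n\cap\mathrm{aff}(P)\to\mathbb Z^m\cap\mathrm{aff}(Q)$ (aff = affine span).
   Formalization: The flow polytopes $\mathcal F_{\hat G}(\hat\alpha)$ and $\mathcal F_G(\alpha)$ consist of points with rational coordinates rather than real ones, and their affine spans are taken over ℚ. -}

module Defs where

open import Data.Nat as ℕ using (ℕ; zero; suc)
open import Data.Integer as ℤ using (ℤ; +_)
open import Data.Rational as ℚ using (ℚ; 0ℚ; 1ℚ)
open import Data.Fin using (Fin; zero; suc; _↑ˡ_; _↑ʳ_; splitAt; _≟_)
open import Data.Bool using (Bool; true; false; if_then_else_)
open import Data.Sum using ([_,_]′)
open import Data.List using (List; []; _∷_)
open import Data.List.Relation.Unary.All using (All)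
open import Data.Product using (Σ; _×_; _,_; ∃)
open import Relation.Nullary.Decidable using (⌊_⌋)
open import Relation.Binary.PropositionalEquality using (_≡_)

sumℚ : (n : ℕ) → (Fin n → ℚ) → ℚ
sumℚ zero    f = 0ℚ
sumℚ (suc n) f = f zero ℚ.+ sumℚ n (λ i → f (suc i))

sumℤ : (n : ℕ) → (Fin n → ℤ) → ℤ
sumℤ zero    f = + 0
sumℤ (suc n) f = f zero ℤ.+ sumℤ n (λ i → f (suc i))

count : (n : ℕ) → (Fin n → Bool) → ℕ
count zero    p = 0
count (suc n) p = (if p zero then 1 else 0) ℕ.+ count n (λ i → p (suc i))

ι : ℤ → ℚ
ι z = z ℚ./ 1

record Graph : Set where
  field
    nV : ℕ
    nE : ℕ
    tl : Fin nE → Fin nV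
    hd : Fin nE → Fin nV
open Graph public

data Walk (G : Graph) : Fin (nV G) → Fin (nV G) → Set where
  nil  : ∀ {v} → Walk G v v
  step : ∀ {u w} (e : Fin (nE G)) → tl G e ≡ u → Walk G (hd G e) w → Walk G u w

walkLength : ∀ {G u w} → Walk G u w → ℕ
walkLength nil          = 0
walkLength (step _ _ p) = suc (walkLength p)

IsDAG : Graph → Set
IsDAG G = ∀ v → (p : Walk G v v) → walkLength p ≡ 0

Point : ℕ → Set
Point n = Fin n → ℚ

outflow : (G : Graph) → Point (nE G) → Fin (nV G) → ℚ
outflow G F i = sumℚ (nE G) (λ e → if ⌊ tl G e ≟ i ⌋ then F e else 0ℚ)

inflow : (G : Graph) → Point (nE G) → Fin (nV G) → ℚ
inflow G F i = sumℚ (nE G) (λ e → if ⌊ hd G e ≟ i ⌋ then F e else 0ℚ)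

FlowPolytope : (G : Graph) → (Fin (nV G) → ℤ) → Point (nE G) → Set
FlowPolytope G β F =
  (∀ e → 0ℚ ℚ.≤ F e) × (∀ i → outflow G F i ℚ.- inflow G F i ≡ ι (β i))

Spos : (n : ℕ) → (Fin n → ℤ) → ℤ
Spos n α = sumℤ n (λ i → if ⌊ + 0 ℤ.<? α i ⌋ then α i else + 0)

-- Vertices of Ĝ: Fin (nV + (nX + nY)) = V ⊔ V_X ⊔ V_Y,
-- edges of Ĝ:    Fin (nE + (mX + mY)) = E ⊔ E_X ⊔ E_Y.
-- E_X-edges go from V_X to V, E_Y-edges go from V to V_Y.
record Augmentation (G : Graph) (α : Fin (nV G) → ℤ) : Set where
  field
    nX nY mX mY : ℕ
    xTail : Fin mX → Fin nX
    xHead : Fin mX → Fin (nV G)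
    yTail : Fin mY → Fin (nV G)
    yHead : Fin mY → Fin nY
    α̂Y    : Fin nY → ℤ
    EX-size   : + mX ≡ Spos (nV G) α
    EX-head   : ∀ x → + 0 ℤ.< α (xHead x)
    EX-count  : ∀ i → + 0 ℤ.< α i → + (count mX (λ x → ⌊ xHead x ≟ i ⌋)) ≡ α i
    EY-tail   : ∀ y → α (yTail y) ℤ.< + 0
    EY-count≥ : ∀ i → α i ℤ.< + 0 → 1 ℕ.≤ count mY (λ y → ⌊ yTail y ≟ i ⌋)
    EY-count≤ : ∀ i → α i ℤ.< + 0 → count mY (λ y → ⌊ yTail y ≟ i ⌋) ℕ.≤ ℤ.∣ α i ∣
    -- each vertex of V_X (resp. V_Y) is incident to exactly one edge of Ĝ
    -- (by construction only E_X-tails touch V_X and only E_Y-heads touch V_Y)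
    VX-inc    : ∀ v → count mX (λ x → ⌊ xTail x ≟ v ⌋) ≡ 1
    VY-inc    : ∀ v → count mY (λ y → ⌊ yHead y ≟ v ⌋) ≡ 1
    α̂Y-neg    : ∀ v → α̂Y v ℤ.< + 0
    α-split   : ∀ i → α i ℤ.< + 0 →
                α i ≡ sumℤ mY (λ y → if ⌊ yTail y ≟ i ⌋ then α̂Y (yHead y) else + 0)

module _ {G : Graph} {α : Fin (nV G) → ℤ} (A : Augmentation G α) where
  open Augmentation A

  vX : Fin nX → Fin (nV G ℕ.+ (nX ℕ.+ nY))
  vX x = nV G ↑ʳ (x ↑ˡ nY)

  vY : Fin nY → Fin (nV G ℕ.+ (nX ℕ.+ nY))
  vY y = nV G ↑ʳ (nX ↑ʳ y)

  vV : Fin (nV G) → Fin (nV G ℕ.+ (nX ℕ.+ nY))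
  vV i = i ↑ˡ (nX ℕ.+ nY)

  augGraph : Graph
  augGraph = record
    { nV = nV G ℕ.+ (nX ℕ.+ nY)
    ; nE = nE G ℕ.+ (mX ℕ.+ mY)
    ; tl = λ e → [ (λ e₀ → vV (tl G e₀))
                 , (λ e₁ → [ (λ x → vX (xTail x)) , (λ y → vV (yTail y)) ]′ (splitAt mX e₁)) ]′
                 (splitAt (nE G) e)
    ; hd = λ e → [ (λ e₀ → vV (hd G e₀))
                 , (λ e₁ → [ (λ x → vV (xHead x)) , (λ y → vY (yHead y)) ]′ (splitAt mX e₁)) ]′
                 (splitAt (nE G) e)
    }

  augNet : Fin (nV G ℕ.+ (nX ℕ.+ nY)) → ℤ
  augNet v = [ (λ _ → + 0) , (λ w → [ (λ _ → + 1) , α̂Y ]′ (splitAt nX w)) ]′ (splitAt (nV G) v)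

  restrict : Point (nE G ℕ.+ (mX ℕ.+ mY)) → Point (nE G)
  restrict F e = F (e ↑ˡ (mX ℕ.+ mY))

_≐_ : ∀ {n} → Point n → Point n → Set
x ≐ y = ∀ j → x j ≡ y j

sumL : List ℚ → ℚ
sumL []       = 0ℚ
sumL (c ∷ cs) = c ℚ.+ sumL cs

combo : ∀ {n} → List (ℚ × Point n) → Point n
combo []             j = 0ℚ
combo ((c , x) ∷ cs) j = c ℚ.* x j ℚ.+ combo cs j

coeffs : ∀ {n} → List (ℚ × Point n) → List ℚ
coeffs []             = []
coeffs ((c , _) ∷ cs) = c ∷ coeffs cs

InAff : ∀ {n} → (Point n → Set) → Point n → Set
InAff {n} P p = Σ (List (ℚ × Point n)) λ cs →
  All (λ cx → P (Data.Product.proj₂ cx)) cs × sumL (coeffs cs) ≡ 1ℚ × p ≐ combo cs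

IsIntegral : ∀ {n} → Point n → Set
IsIntegral p = ∀ j → ∃ λ (z : ℤ) → p j ≡ ι z

IsAffine : ∀ {n m} → (Point n → Point m) → Set
IsAffine {n} {m} φ = Σ (Fin m → Fin n → ℚ) λ M → Σ (Point m) λ b →
  ∀ x k → φ x k ≡ sumℚ n (λ j → M k j ℚ.* x j) ℚ.+ b k

BijOn : ∀ {n m} → (Point n → Point m) → (Point n → Set) → (Point m → Set) → Set
BijOn φ S T =
  (∀ x → S x → T (φ x)) ×
  (∀ x y → S x → S y → φ x ≐ φ y → x ≐ y) ×
  (∀ y → T y → ∃ λ x → S x × φ x ≐ y)

IntegralEquivalence : ∀ {n m} → (Point n → Point m) → (Point n → Set) → (Point m → Set) → Set
IntegralEquivalence φ P Q =
  IsAffine φ ×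
  BijOn φ P Q ×
  BijOn φ (λ x → IsIntegral x × InAff P x) (λ y → IsIntegral y × InAff Q y)

-- Each vertex of V_X and of V_Y lies on exactly one edge, so conservation there pins the flow of
-- Ĝ on E_X to 1 and on an edge y of E_Y to -α̂(h(y)).  These values are integers and, being
-- constant on 𝓕_Ĝ(α̂), they are constant on its affine span too; hence F ↦ F|_E is injective on
-- that span, with inverse "extend by the pinned values", which keeps integral points integral.
-- At a vertex i of G the pinned edges carry in #{x ∈ E_X : h(x) = i} and carry out
-- -Σ_{t(y) = i} α̂(h(y)), and by the defining properties of an augmentation these add up to α_i
-- (only one of the two is non-zero, according to the sign of α_i).  So conservation in Ĝ at i is
-- exactly conservation in G with netflow α_i.
{-# OPTIONS --safe #-}
module Submission where

import Algebra.Properties.Group as GroupProperties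
open import Data.Bool using (Bool; true; false; if_then_else_)
open import Data.Empty using (⊥-elim)
open import Data.Fin using (Fin; zero; suc; _↑ˡ_; _↑ʳ_; splitAt; _≟_)
import Data.Fin.Properties as FinP
open import Data.Integer as ℤ using (ℤ; +_; -[1+_])
import Data.Integer.Properties as ℤP
open import Data.List as List using (List; []; _∷_)
open import Data.List.Relation.Unary.All as All using (All; []; _∷_)
import Data.List.Relation.Unary.All.Properties as AllP
open import Data.Nat as ℕ using (ℕ; zero; suc)
import Data.Nat.Properties as ℕP
open import Data.Product as Product using (_×_; _,_; ∃; proj₁; proj₂)
open import Data.Rational as ℚ using (ℚ; 0ℚ; 1ℚ)
import Data.Rational.Properties as ℚP
open import Data.Rational.Solver using (module +-*-Solver)
import Data.Rational.Unnormalised as ℚᵘ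
import Data.Rational.Unnormalised.Properties as ℚᵘP
open import Data.Sum using (inj₁; inj₂; [_,_]′)
open import Function using (_∘_; const; mk⇔)
open import Function.Definitions using (Injective)
open import Relation.Binary.Definitions using (tri<; tri≈; tri>)
open import Relation.Binary.PropositionalEquality
open import Relation.Nullary using (¬_; yes; no)
open import Relation.Nullary.Decidable using (⌊_⌋; isYes≗does; does-⇔; dec-true; dec-false)

open import Defs

open +-*-Solver using (solve; _:+_; _:-_; :-_; _:=_; con)
open GroupProperties ℚP.+-0-group using (x∙y⁻¹≈ε⇒x≈y; ⁻¹-involutive)

toℚᵘ-ι : ∀ z → ℚ.toℚᵘ (ι z) ℚᵘ.≃ ℚᵘ.mkℚᵘ z 0
toℚᵘ-ι z = ℚP.toℚᵘ-fromℚᵘ (ℚᵘ.mkℚᵘ z 0)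

ι-+ : ∀ a b → ι (a ℤ.+ b) ≡ ι a ℚ.+ ι b
ι-+ a b = ℚP.toℚᵘ-injective (begin
  ℚ.toℚᵘ (ι (a ℤ.+ b))
    ≈⟨ toℚᵘ-ι (a ℤ.+ b) ⟩
  ℚᵘ.mkℚᵘ (a ℤ.+ b) 0
    ≈⟨ ℚᵘ.*≡* (cong (ℤ._* + 1) (sym (cong₂ ℤ._+_ (ℤP.*-identityʳ a) (ℤP.*-identityʳ b)))) ⟩
  ℚᵘ.mkℚᵘ a 0 ℚᵘ.+ ℚᵘ.mkℚᵘ b 0
    ≈⟨ ℚᵘP.+-cong (toℚᵘ-ι a) (toℚᵘ-ι b) ⟨
  ℚ.toℚᵘ (ι a) ℚᵘ.+ ℚ.toℚᵘ (ι b)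
    ≈⟨ ℚP.toℚᵘ-homo-+ (ι a) (ι b) ⟨
  ℚ.toℚᵘ (ι a ℚ.+ ι b) ∎)
  where open ℚᵘP.≃-Reasoning

ι-neg : ∀ a → ι (ℤ.- a) ≡ ℚ.- ι a
ι-neg a = ℚP.toℚᵘ-injective (begin
  ℚ.toℚᵘ (ι (ℤ.- a))    ≈⟨ toℚᵘ-ι (ℤ.- a) ⟩
  ℚᵘ.- ℚᵘ.mkℚᵘ a 0      ≈⟨ ℚᵘP.-‿cong (toℚᵘ-ι a) ⟨
  ℚᵘ.- ℚ.toℚᵘ (ι a)     ≈⟨ ℚP.toℚᵘ-homo‿- (ι a) ⟨
  ℚ.toℚᵘ (ℚ.- ι a)      ∎)
  where open ℚᵘP.≃-Reasoning

neg-ι-nonNeg : ∀ z → z ℤ.< + 0 → 0ℚ ℚ.≤ ℚ.- ι z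
neg-ι-nonNeg (+ k)     (ℤ.+<+ ())
neg-ι-nonNeg -[1+ k ] _ =
  subst (0ℚ ℚ.≤_) (ι-neg -[1+ k ])
        (ℚP.nonNegative⁻¹ (ι (+ suc k)) {{ℚP.normalize-nonNeg (suc k) 1}})

⌊≟⌋-≡ : ∀ {n} {i j : Fin n} → i ≡ j → ⌊ i ≟ j ⌋ ≡ true
⌊≟⌋-≡ {i = i} {j} i≡j = trans (isYes≗does (i ≟ j)) (dec-true (i ≟ j) i≡j)

⌊≟⌋-≢ : ∀ {n} {i j : Fin n} → i ≢ j → ⌊ i ≟ j ⌋ ≡ false
⌊≟⌋-≢ {i = i} {j} i≢j = trans (isYes≗does (i ≟ j)) (dec-false (i ≟ j) i≢j)

⌊≟⌋-injective : ∀ {m n} {f : Fin m → Fin n} → Injective _≡_ _≡_ f →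
                ∀ i j → ⌊ f i ≟ f j ⌋ ≡ ⌊ i ≟ j ⌋
⌊≟⌋-injective {f = f} f-inj i j = begin
  ⌊ f i ≟ f j ⌋   ≡⟨ isYes≗does (f i ≟ f j) ⟩
  _               ≡⟨ does-⇔ (mk⇔ f-inj (cong f)) (f i ≟ f j) (i ≟ j) ⟩
  _               ≡⟨ isYes≗does (i ≟ j) ⟨
  ⌊ i ≟ j ⌋       ∎
  where open ≡-Reasoning

sumℚ-cong : ∀ n {f g : Fin n → ℚ} → (∀ i → f i ≡ g i) → sumℚ n f ≡ sumℚ n g
sumℚ-cong zero    f≗g = refl
sumℚ-cong (suc n) f≗g = cong₂ ℚ._+_ (f≗g zero) (sumℚ-cong n (f≗g ∘ suc))

sumℚ-+ : ∀ a b (f : Fin (a ℕ.+ b) → ℚ) →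
         sumℚ (a ℕ.+ b) f ≡ sumℚ a (f ∘ (_↑ˡ b)) ℚ.+ sumℚ b (f ∘ (a ↑ʳ_))
sumℚ-+ zero    b f = sym (ℚP.+-identityˡ _)
sumℚ-+ (suc a) b f = trans (cong (f zero ℚ.+_) (sumℚ-+ a b (f ∘ suc))) (sym (ℚP.+-assoc (f zero) _ _))

sumℚ-if-congˡ : ∀ n {p q : Fin n → Bool} (f : Fin n → ℚ) → (∀ i → p i ≡ q i) →
                sumℚ n (λ i → if p i then f i else 0ℚ) ≡ sumℚ n (λ i → if q i then f i else 0ℚ)
sumℚ-if-congˡ n f p≗q = sumℚ-cong n (λ i → cong (λ b → if b then f i else 0ℚ) (p≗q i))

sumℚ-if-congʳ : ∀ n (p : Fin n → Bool) {f g : Fin n → ℚ} → (∀ i → f i ≡ g i) →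
                sumℚ n (λ i → if p i then f i else 0ℚ) ≡ sumℚ n (λ i → if p i then g i else 0ℚ)
sumℚ-if-congʳ n p f≗g = sumℚ-cong n (λ i → cong (λ q → if p i then q else 0ℚ) (f≗g i))

sumℚ-fiber-cong : ∀ n {m} {g h : Fin n → Fin m} (f : Fin n → ℚ) v → (∀ i → g i ≡ h i) →
                  sumℚ n (λ i → if ⌊ g i ≟ v ⌋ then f i else 0ℚ) ≡
                  sumℚ n (λ i → if ⌊ h i ≟ v ⌋ then f i else 0ℚ)
sumℚ-fiber-cong n f v g≗h = sumℚ-if-congˡ n f (λ i → cong (λ u → ⌊ u ≟ v ⌋) (g≗h i))

sumℚ-if-none : ∀ n {p : Fin n → Bool} (f : Fin n → ℚ) → (∀ i → p i ≡ false) →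
               sumℚ n (λ i → if p i then f i else 0ℚ) ≡ 0ℚ
sumℚ-if-none zero    f none = refl
sumℚ-if-none (suc n) f none rewrite none zero =
  trans (ℚP.+-identityˡ _) (sumℚ-if-none n (f ∘ suc) (none ∘ suc))

sumℤ-if-none : ∀ n {p : Fin n → Bool} (g : Fin n → ℤ) → (∀ i → p i ≡ false) →
               sumℤ n (λ i → if p i then g i else + 0) ≡ + 0
sumℤ-if-none zero    g none = refl
sumℤ-if-none (suc n) g none rewrite none zero =
  trans (ℤP.+-identityˡ _) (sumℤ-if-none n (g ∘ suc) (none ∘ suc))

count-none : ∀ n {p : Fin n → Bool} → (∀ i → p i ≡ false) → count n p ≡ 0
count-none zero    none = refl
count-none (suc n) none rewrite none zero = count-none n (none ∘ suc)

count≡0⇒none : ∀ n (p : Fin n → Bool) → count n p ≡ 0 → ∀ i → p i ≡ false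
count≡0⇒none (suc n) p c≡0 i with p zero in p0
count≡0⇒none (suc n) p ()  i       | true
count≡0⇒none (suc n) p c≡0 zero    | false = p0
count≡0⇒none (suc n) p c≡0 (suc i) | false = count≡0⇒none n (p ∘ suc) c≡0 i

count-fiber-witness : ∀ n {m} (g : Fin n → Fin m) v {c} →
                      count n (λ i → ⌊ g i ≟ v ⌋) ≡ suc c → ∃ λ k → g k ≡ v
count-fiber-witness (suc n) g v c≡1+ with g zero ≟ v
... | yes g0≡v = zero , g0≡v
... | no  _    with k , gk≡v ← count-fiber-witness n (g ∘ suc) v c≡1+ = suc k , gk≡v

sumℚ-fiber-unique : ∀ n {m} (g : Fin n → Fin m) v (f : Fin n → ℚ) →
                    count n (λ i → ⌊ g i ≟ v ⌋) ≡ 1 → ∀ k → g k ≡ v →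
                    sumℚ n (λ i → if ⌊ g i ≟ v ⌋ then f i else 0ℚ) ≡ f k
sumℚ-fiber-unique (suc n) g v f c≡1 k gk≡v with g zero ≟ v
sumℚ-fiber-unique (suc n) g v f c≡1 zero    _ | yes _ =
  trans (cong (f zero ℚ.+_) (sumℚ-if-none n (f ∘ suc) (count≡0⇒none n _ (ℕP.suc-injective c≡1))))
        (ℚP.+-identityʳ (f zero))
sumℚ-fiber-unique (suc n) g v f c≡1 (suc k) gk≡v | yes _
  with () ← trans (sym (⌊≟⌋-≡ gk≡v)) (count≡0⇒none n _ (ℕP.suc-injective c≡1) k)
sumℚ-fiber-unique (suc n) g v f c≡1 zero    g0≡v | no g0≢v = ⊥-elim (g0≢v g0≡v)
sumℚ-fiber-unique (suc n) g v f c≡1 (suc k) gk≡v | no _ =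
  trans (ℚP.+-identityˡ _) (sumℚ-fiber-unique n (g ∘ suc) v (f ∘ suc) c≡1 k gk≡v)

sumℚ-indicator : ∀ n (p : Fin n → Bool) → sumℚ n (λ i → if p i then 1ℚ else 0ℚ) ≡ ι (+ count n p)
sumℚ-indicator zero    p = refl
sumℚ-indicator (suc n) p = trans (cong₂ ℚ._+_ (head (p zero)) (sumℚ-indicator n (p ∘ suc)))
                            (sym (ι-+ (+ (if p zero then 1 else 0)) (+ count n (p ∘ suc))))
  where
  head : ∀ b → (if b then 1ℚ else 0ℚ) ≡ ι (+ (if b then 1 else 0))
  head true  = refl
  head false = refl

sumℚ-if-neg-ι : ∀ n (p : Fin n → Bool) (g : Fin n → ℤ) →
                sumℚ n (λ i → if p i then ℚ.- ι (g i) else 0ℚ) ≡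
                ℚ.- ι (sumℤ n (λ i → if p i then g i else + 0))
sumℚ-if-neg-ι zero    p g = refl
sumℚ-if-neg-ι (suc n) p g = begin
  _                         ≡⟨ cong₂ ℚ._+_ (head (p zero)) (sumℚ-if-neg-ι n (p ∘ suc) (g ∘ suc)) ⟩
  ℚ.- ι g₀ ℚ.+ ℚ.- ι rest   ≡⟨ ℚP.neg-distrib-+ (ι g₀) (ι rest) ⟨
  ℚ.- (ι g₀ ℚ.+ ι rest)     ≡⟨ cong ℚ.-_ (ι-+ g₀ rest) ⟨
  ℚ.- ι (g₀ ℤ.+ rest)       ∎
  where
  open ≡-Reasoning
  g₀ = if p zero then g zero else + 0
  rest = sumℤ n (λ i → if p (suc i) then g (suc i) else + 0)
  head : ∀ b → (if b then ℚ.- ι (g zero) else 0ℚ) ≡ ℚ.- ι (if b then g zero else + 0)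
  head true  = refl
  head false = refl

sumℚ-delta : ∀ n (k : Fin n) (x : Fin n → ℚ) →
             sumℚ n (λ j → (if ⌊ k ≟ j ⌋ then 1ℚ else 0ℚ) ℚ.* x j) ≡ x k
sumℚ-delta (suc n) zero x = begin
  1ℚ ℚ.* x zero ℚ.+ sumℚ n (λ j → 0ℚ ℚ.* x (suc j))
    ≡⟨ cong₂ ℚ._+_ (ℚP.*-identityˡ (x zero)) (sumℚ-cong n (ℚP.*-zeroˡ ∘ x ∘ suc)) ⟩
  x zero ℚ.+ sumℚ n (const 0ℚ)
    ≡⟨ cong (x zero ℚ.+_) (sumℚ-if-none n (const 0ℚ) (const refl)) ⟩
  x zero ℚ.+ 0ℚ
    ≡⟨ ℚP.+-identityʳ (x zero) ⟩
  x zero ∎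
  where open ≡-Reasoning
sumℚ-delta (suc n) (suc k) x = begin
  0ℚ ℚ.* x zero ℚ.+ sumℚ n (λ j → δ (suc k) (suc j) ℚ.* x (suc j))
    ≡⟨ cong₂ ℚ._+_ (ℚP.*-zeroˡ (x zero))
                   (sumℚ-cong n (λ j → cong (λ b → (if b then 1ℚ else 0ℚ) ℚ.* x (suc j))
                                            (⌊≟⌋-injective FinP.suc-injective k j))) ⟩
  0ℚ ℚ.+ sumℚ n (λ j → δ k j ℚ.* x (suc j))
    ≡⟨ ℚP.+-identityˡ _ ⟩
  sumℚ n (λ j → δ k j ℚ.* x (suc j))
    ≡⟨ sumℚ-delta n k (x ∘ suc) ⟩
  x (suc k) ∎
  where
  open ≡-Reasoning
  δ : ∀ {m} → Fin m → Fin m → ℚ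
  δ i j = if ⌊ i ≟ j ⌋ then 1ℚ else 0ℚ

module Fin³ (a b c : ℕ) where

  in₁ : Fin a → Fin (a ℕ.+ (b ℕ.+ c))
  in₁ i = i ↑ˡ (b ℕ.+ c)

  in₂ : Fin b → Fin (a ℕ.+ (b ℕ.+ c))
  in₂ j = a ↑ʳ (j ↑ˡ c)

  in₃ : Fin c → Fin (a ℕ.+ (b ℕ.+ c))
  in₃ k = a ↑ʳ (b ↑ʳ k)

  case³ : ∀ {X : Set} → (Fin a → X) → (Fin b → X) → (Fin c → X) → Fin (a ℕ.+ (b ℕ.+ c)) → X
  case³ f g h = [ f , [ g , h ]′ ∘ splitAt b ]′ ∘ splitAt a

  module _ {X : Set} (f : Fin a → X) (g : Fin b → X) (h : Fin c → X) where

    case³-in₁ : ∀ i → case³ f g h (in₁ i) ≡ f i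
    case³-in₁ i = cong [ f , [ g , h ]′ ∘ splitAt b ]′ (FinP.splitAt-↑ˡ a i (b ℕ.+ c))

    case³-in₂ : ∀ j → case³ f g h (in₂ j) ≡ g j
    case³-in₂ j rewrite FinP.splitAt-↑ʳ a (b ℕ.+ c) (j ↑ˡ c) =
      cong [ g , h ]′ (FinP.splitAt-↑ˡ b j c)

    case³-in₃ : ∀ k → case³ f g h (in₃ k) ≡ h k
    case³-in₃ k rewrite FinP.splitAt-↑ʳ a (b ℕ.+ c) (b ↑ʳ k) =
      cong [ g , h ]′ (FinP.splitAt-↑ʳ b c k)

  in-elim : (P : Fin (a ℕ.+ (b ℕ.+ c)) → Set) →
            (∀ i → P (in₁ i)) → (∀ j → P (in₂ j)) → (∀ k → P (in₃ k)) → ∀ v → P v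
  in-elim P p₁ p₂ p₃ v with splitAt a v in split₁
  ... | inj₁ i = subst P (FinP.splitAt⁻¹-↑ˡ split₁) (p₁ i)
  ... | inj₂ w with splitAt b w in split₂
  ...   | inj₁ j = subst P (trans (cong (a ↑ʳ_) (FinP.splitAt⁻¹-↑ˡ split₂)) w≡v) (p₂ j)
    where w≡v = FinP.splitAt⁻¹-↑ʳ split₁
  ...   | inj₂ k = subst P (trans (cong (a ↑ʳ_) (FinP.splitAt⁻¹-↑ʳ split₂)) w≡v) (p₃ k)
    where w≡v = FinP.splitAt⁻¹-↑ʳ split₁

  in₁-injective : Injective _≡_ _≡_ in₁
  in₁-injective = FinP.↑ˡ-injective (b ℕ.+ c) _ _

  in₂-injective : Injective _≡_ _≡_ in₂
  in₂-injective = FinP.↑ˡ-injective c _ _ ∘ FinP.↑ʳ-injective a _ _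

  in₃-injective : Injective _≡_ _≡_ in₃
  in₃-injective = FinP.↑ʳ-injective b _ _ ∘ FinP.↑ʳ-injective a _ _

  private
    block : Fin (a ℕ.+ (b ℕ.+ c)) → ℕ
    block = case³ (const 0) (const 1) (const 2)

    block-in₁ : ∀ i → block (in₁ i) ≡ 0
    block-in₁ = case³-in₁ (const 0) (const 1) (const 2)
    block-in₂ : ∀ j → block (in₂ j) ≡ 1
    block-in₂ = case³-in₂ (const 0) (const 1) (const 2)
    block-in₃ : ∀ k → block (in₃ k) ≡ 2
    block-in₃ = case³-in₃ (const 0) (const 1) (const 2)

  in₁≢in₂ : ∀ i j → in₁ i ≢ in₂ j
  in₁≢in₂ i j eq with () ← trans (sym (block-in₁ i)) (trans (cong block eq) (block-in₂ j))

  in₁≢in₃ : ∀ i k → in₁ i ≢ in₃ k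
  in₁≢in₃ i k eq with () ← trans (sym (block-in₁ i)) (trans (cong block eq) (block-in₃ k))

  in₂≢in₃ : ∀ j k → in₂ j ≢ in₃ k
  in₂≢in₃ j k eq with () ← trans (sym (block-in₂ j)) (trans (cong block eq) (block-in₃ k))

  sumℚ-+³ : ∀ (f : Fin (a ℕ.+ (b ℕ.+ c)) → ℚ) → sumℚ (a ℕ.+ (b ℕ.+ c)) f ≡
            sumℚ a (f ∘ in₁) ℚ.+ (sumℚ b (f ∘ in₂) ℚ.+ sumℚ c (f ∘ in₃))
  sumℚ-+³ f =
    trans (sumℚ-+ a (b ℕ.+ c) f) (cong (sumℚ a (f ∘ in₁) ℚ.+_) (sumℚ-+ b c (f ∘ (a ↑ʳ_))))

combo-const : ∀ {n} (cs : List (ℚ × Point n)) j k → All (λ cx → proj₂ cx j ≡ k) cs →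
              combo cs j ≡ sumL (coeffs cs) ℚ.* k
combo-const []             j k []           = sym (ℚP.*-zeroˡ k)
combo-const ((c , x) ∷ cs) j k (xj≡k ∷ all) =
  trans (cong₂ (λ u v → c ℚ.* u ℚ.+ v) xj≡k (combo-const cs j k all))
        (sym (ℚP.*-distribʳ-+ k c (sumL (coeffs cs))))

affineCombo-const : ∀ {n} (cs : List (ℚ × Point n)) j k → sumL (coeffs cs) ≡ 1ℚ →
                    All (λ cx → proj₂ cx j ≡ k) cs → combo cs j ≡ k
affineCombo-const cs j k Σc≡1 all =
  trans (combo-const cs j k all) (trans (cong (ℚ._* k) Σc≡1) (ℚP.*-identityˡ k))

InAff-const : ∀ {n} {P : Point n → Set} j k → (∀ x → P x → x j ≡ k) →
              ∀ {x} → InAff P x → x j ≡ k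
InAff-const j k P⇒xj≡k (cs , inP , Σc≡1 , x≐combo) =
  trans (x≐combo j) (affineCombo-const cs j k Σc≡1 (All.map (λ {cx} → P⇒xj≡k (proj₂ cx)) inP))

mapPoints : ∀ {n m} → (Point n → Point m) → List (ℚ × Point n) → List (ℚ × Point m)
mapPoints φ = List.map (Product.map₂ φ)

coeffs-mapPoints : ∀ {n m} (φ : Point n → Point m) cs → coeffs (mapPoints φ cs) ≡ coeffs cs
coeffs-mapPoints φ []             = refl
coeffs-mapPoints φ ((c , _) ∷ cs) = cong (c ∷_) (coeffs-mapPoints φ cs)

combo-mapPoints : ∀ {n m} (φ : Point n → Point m) cs j k → (∀ x → φ x j ≡ x k) →
                  combo (mapPoints φ cs) j ≡ combo cs k
combo-mapPoints φ []             j k φj≡k = refl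
combo-mapPoints φ ((c , x) ∷ cs) j k φj≡k =
  cong₂ (λ u v → c ℚ.* u ℚ.+ v) (φj≡k x) (combo-mapPoints φ cs j k φj≡k)

mapPoints-affineCombo-const : ∀ {n m} (φ : Point n → Point m) cs j k → sumL (coeffs cs) ≡ 1ℚ →
                              (∀ x → φ x j ≡ k) → combo (mapPoints φ cs) j ≡ k
mapPoints-affineCombo-const φ cs j k Σc≡1 φj≡k =
  affineCombo-const (mapPoints φ cs) j k (trans (cong sumL (coeffs-mapPoints φ cs)) Σc≡1)
                    (AllP.map⁺ (All.universal (φj≡k ∘ proj₂) cs))

PreservesAffineCombinations : ∀ {n m} → (Point n → Point m) → Set
PreservesAffineCombinations φ =
  ∀ cs x → sumL (coeffs cs) ≡ 1ℚ → x ≐ combo cs → φ x ≐ combo (mapPoints φ cs)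

InAff-image : ∀ {n m} {P : Point n → Set} {Q : Point m → Set} (φ : Point n → Point m) →
              (∀ x → P x → Q (φ x)) → PreservesAffineCombinations φ →
              ∀ {x} → InAff P x → InAff Q (φ x)
InAff-image φ P⇒Q φ-affine {x} (cs , inP , Σc≡1 , x≐combo) =
  mapPoints φ cs ,
  AllP.map⁺ (All.map (λ {cx} → P⇒Q (proj₂ cx)) inP) ,
  trans (cong sumL (coeffs-mapPoints φ cs)) Σc≡1 ,
  φ-affine cs x Σc≡1 x≐combo

reindex-isAffine : ∀ {n m} (σ : Fin m → Fin n) → IsAffine (λ (x : Point n) → x ∘ σ)
reindex-isAffine {n} σ =
  (λ k j → if ⌊ σ k ≟ j ⌋ then 1ℚ else 0ℚ) , const 0ℚ ,
  λ x k → sym (trans (ℚP.+-identityʳ _) (sumℚ-delta n (σ k) x))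

reindex-preservesAffineCombinations : ∀ {n m} (σ : Fin m → Fin n) →
  PreservesAffineCombinations (λ (x : Point n) → x ∘ σ)
reindex-preservesAffineCombinations σ cs x _ x≐combo j =
  trans (x≐combo (σ j)) (sym (combo-mapPoints (_∘ σ) cs j (σ j) (λ _ → refl)))

netflow : (G : Graph) → Point (nE G) → Fin (nV G) → ℚ
netflow G F i = outflow G F i ℚ.- inflow G F i

netflow-cong : ∀ G {F F′} → F ≐ F′ → ∀ i → netflow G F i ≡ netflow G F′ i
netflow-cong G F≐F′ i =
  cong₂ ℚ._-_ (sumℚ-if-congʳ (nE G) (λ e → ⌊ tl G e ≟ i ⌋) F≐F′)
              (sumℚ-if-congʳ (nE G) (λ e → ⌊ hd G e ≟ i ⌋) F≐F′)

module _ {G : Graph} {α : Fin (nV G) → ℤ} (A : Augmentation G α) where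
  open Augmentation A

  private
    Ĝ : Graph
    Ĝ = augGraph A

  module E = Fin³ (nE G) mX mY
  module V = Fin³ (nV G) nX nY
  open E using () renaming (in₁ to eE; in₂ to eX; in₃ to eY)

  -- tl Ĝ, hd Ĝ and augNet A are definitionally instances of case³.
  tl-eE : ∀ e → tl Ĝ (eE e) ≡ vV A (tl G e)
  tl-eE = E.case³-in₁ (vV A ∘ tl G) (vX A ∘ xTail) (vV A ∘ yTail)
  tl-eX : ∀ x → tl Ĝ (eX x) ≡ vX A (xTail x)
  tl-eX = E.case³-in₂ (vV A ∘ tl G) (vX A ∘ xTail) (vV A ∘ yTail)
  tl-eY : ∀ y → tl Ĝ (eY y) ≡ vV A (yTail y)
  tl-eY = E.case³-in₃ (vV A ∘ tl G) (vX A ∘ xTail) (vV A ∘ yTail)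

  hd-eE : ∀ e → hd Ĝ (eE e) ≡ vV A (hd G e)
  hd-eE = E.case³-in₁ (vV A ∘ hd G) (vV A ∘ xHead) (vY A ∘ yHead)
  hd-eX : ∀ x → hd Ĝ (eX x) ≡ vV A (xHead x)
  hd-eX = E.case³-in₂ (vV A ∘ hd G) (vV A ∘ xHead) (vY A ∘ yHead)
  hd-eY : ∀ y → hd Ĝ (eY y) ≡ vY A (yHead y)
  hd-eY = E.case³-in₃ (vV A ∘ hd G) (vV A ∘ xHead) (vY A ∘ yHead)

  augNet-vV : ∀ i → augNet A (vV A i) ≡ + 0
  augNet-vV = V.case³-in₁ (const (+ 0)) (const (+ 1)) α̂Y
  augNet-vX : ∀ v → augNet A (vX A v) ≡ + 1
  augNet-vX = V.case³-in₂ (const (+ 0)) (const (+ 1)) α̂Y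
  augNet-vY : ∀ v → augNet A (vY A v) ≡ α̂Y v
  augNet-vY = V.case³-in₃ (const (+ 0)) (const (+ 1)) α̂Y

  module _ (F : Point (nE Ĝ)) where

    outflow-split : ∀ w → outflow Ĝ F w ≡
      sumℚ (nE G) (λ e → if ⌊ vV A (tl G e) ≟ w ⌋ then F (eE e) else 0ℚ) ℚ.+
      (sumℚ mX (λ x → if ⌊ vX A (xTail x) ≟ w ⌋ then F (eX x) else 0ℚ) ℚ.+
       sumℚ mY (λ y → if ⌊ vV A (yTail y) ≟ w ⌋ then F (eY y) else 0ℚ))
    outflow-split w = trans (E.sumℚ-+³ _)
      (cong₂ ℚ._+_ (sumℚ-fiber-cong (nE G) (F ∘ eE) w tl-eE)
        (cong₂ ℚ._+_ (sumℚ-fiber-cong mX (F ∘ eX) w tl-eX) (sumℚ-fiber-cong mY (F ∘ eY) w tl-eY)))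

    inflow-split : ∀ w → inflow Ĝ F w ≡
      sumℚ (nE G) (λ e → if ⌊ vV A (hd G e) ≟ w ⌋ then F (eE e) else 0ℚ) ℚ.+
      (sumℚ mX (λ x → if ⌊ vV A (xHead x) ≟ w ⌋ then F (eX x) else 0ℚ) ℚ.+
       sumℚ mY (λ y → if ⌊ vY A (yHead y) ≟ w ⌋ then F (eY y) else 0ℚ))
    inflow-split w = trans (E.sumℚ-+³ _)
      (cong₂ ℚ._+_ (sumℚ-fiber-cong (nE G) (F ∘ eE) w hd-eE)
        (cong₂ ℚ._+_ (sumℚ-fiber-cong mX (F ∘ eX) w hd-eX) (sumℚ-fiber-cong mY (F ∘ eY) w hd-eY)))

    private
      same-block : ∀ {k} (f : Fin k → ℚ) (t : Fin k → Fin (nV G)) i →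
                   sumℚ k (λ e → if ⌊ vV A (t e) ≟ vV A i ⌋ then f e else 0ℚ) ≡
                   sumℚ k (λ e → if ⌊ t e ≟ i ⌋ then f e else 0ℚ)
      same-block {k} f t i = sumℚ-if-congˡ k f (λ e → ⌊≟⌋-injective V.in₁-injective (t e) i)

      other-block : ∀ {k} (f : Fin k → ℚ) {t : Fin k → Fin (nV Ĝ)} {w} → (∀ e → t e ≢ w) →
                    sumℚ k (λ e → if ⌊ t e ≟ w ⌋ then f e else 0ℚ) ≡ 0ℚ
      other-block {k} f t≢w = sumℚ-if-none k f (λ e → ⌊≟⌋-≢ (t≢w e))

    netflow-vV : ∀ i → netflow Ĝ F (vV A i) ≡ netflow G (restrict A F) i ℚ.+
      (sumℚ mY (λ y → if ⌊ yTail y ≟ i ⌋ then F (eY y) else 0ℚ) ℚ.-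
       sumℚ mX (λ x → if ⌊ xHead x ≟ i ⌋ then F (eX x) else 0ℚ))
    netflow-vV i = begin
      netflow Ĝ F (vV A i)
        ≡⟨ cong₂ ℚ._-_
             (trans (outflow-split (vV A i))
               (cong₂ ℚ._+_ (same-block (F ∘ eE) (tl G) i)
                 (cong₂ ℚ._+_ (other-block (F ∘ eX) (λ x → V.in₁≢in₂ i (xTail x) ∘ sym))
                              (same-block (F ∘ eY) yTail i))))
             (trans (inflow-split (vV A i))
               (cong₂ ℚ._+_ (same-block (F ∘ eE) (hd G) i)
                 (cong₂ ℚ._+_ (same-block (F ∘ eX) xHead i)
                              (other-block (F ∘ eY) (λ y → V.in₁≢in₃ i (yHead y) ∘ sym))))) ⟩
      (out ℚ.+ (0ℚ ℚ.+ fromY)) ℚ.- (in′ ℚ.+ (intoX ℚ.+ 0ℚ))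
        ≡⟨ solve 4 (λ o ı y x → (o :+ (con 0ℚ :+ y)) :- (ı :+ (x :+ con 0ℚ)) := (o :- ı) :+ (y :- x))
                 refl out in′ fromY intoX ⟩
      (out ℚ.- in′) ℚ.+ (fromY ℚ.- intoX) ∎
      where
      open ≡-Reasoning
      out = outflow G (restrict A F) i
      in′ = inflow G (restrict A F) i
      fromY = sumℚ mY (λ y → if ⌊ yTail y ≟ i ⌋ then F (eY y) else 0ℚ)
      intoX = sumℚ mX (λ x → if ⌊ xHead x ≟ i ⌋ then F (eX x) else 0ℚ)

    netflow-vX : ∀ v → netflow Ĝ F (vX A v) ≡
                       sumℚ mX (λ x → if ⌊ xTail x ≟ v ⌋ then F (eX x) else 0ℚ)
    netflow-vX v = trans
      (cong₂ ℚ._-_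
        (trans (outflow-split (vX A v))
          (cong₂ ℚ._+_ (other-block (F ∘ eE) (λ e → V.in₁≢in₂ (tl G e) v))
            (cong₂ ℚ._+_ (sumℚ-if-congˡ mX (F ∘ eX) (λ x → ⌊≟⌋-injective V.in₂-injective _ v))
                         (other-block (F ∘ eY) (λ y → V.in₁≢in₂ (yTail y) v)))))
        (other-block F hd≢vX))
      (solve 1 (λ s → (con 0ℚ :+ (s :+ con 0ℚ)) :- con 0ℚ := s) refl _)
      where
      hd≢vX : ∀ e → hd Ĝ e ≢ vX A v
      hd≢vX = E.in-elim _
        (λ e eq → V.in₁≢in₂ (hd G e) v (trans (sym (hd-eE e)) eq))
        (λ x eq → V.in₁≢in₂ (xHead x) v (trans (sym (hd-eX x)) eq))
        (λ y eq → V.in₂≢in₃ v (yHead y) (sym (trans (sym (hd-eY y)) eq)))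

    netflow-vY : ∀ v → netflow Ĝ F (vY A v) ≡
                       ℚ.- sumℚ mY (λ y → if ⌊ yHead y ≟ v ⌋ then F (eY y) else 0ℚ)
    netflow-vY v = trans
      (cong₂ ℚ._-_
        (other-block F tl≢vY)
        (trans (inflow-split (vY A v))
          (cong₂ ℚ._+_ (other-block (F ∘ eE) (λ e → V.in₁≢in₃ (hd G e) v))
            (cong₂ ℚ._+_ (other-block (F ∘ eX) (λ x → V.in₁≢in₃ (xHead x) v))
                         (sumℚ-if-congˡ mY (F ∘ eY) (λ y → ⌊≟⌋-injective V.in₃-injective _ v))))))
      (solve 1 (λ s → con 0ℚ :- (con 0ℚ :+ (con 0ℚ :+ s)) := :- s) refl _)
      where
      tl≢vY : ∀ e → tl Ĝ e ≢ vY A v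
      tl≢vY = E.in-elim _
        (λ e eq → V.in₁≢in₃ (tl G e) v (trans (sym (tl-eE e)) eq))
        (λ x eq → V.in₂≢in₃ (xTail x) v (trans (sym (tl-eX x)) eq))
        (λ y eq → V.in₁≢in₃ (yTail y) v (trans (sym (tl-eY y)) eq))

    netflow-source : ∀ x v → xTail x ≡ v → netflow Ĝ F (vX A v) ≡ F (eX x)
    netflow-source x v xTail≡v =
      trans (netflow-vX v) (sumℚ-fiber-unique mX xTail v (F ∘ eX) (VX-inc v) x xTail≡v)

    netflow-sink : ∀ y v → yHead y ≡ v → netflow Ĝ F (vY A v) ≡ ℚ.- F (eY y)
    netflow-sink y v yHead≡v =
      trans (netflow-vY v) (cong ℚ.-_ (sumℚ-fiber-unique mY yHead v (F ∘ eY) (VY-inc v) y yHead≡v))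

  no-EX-head : ∀ {i} → ¬ + 0 ℤ.< α i → ∀ x → ⌊ xHead x ≟ i ⌋ ≡ false
  no-EX-head 0≮α x = ⌊≟⌋-≢ (λ { refl → 0≮α (EX-head x) })

  no-EY-tail : ∀ {i} → ¬ α i ℤ.< + 0 → ∀ y → ⌊ yTail y ≟ i ⌋ ≡ false
  no-EY-tail α≮0 y = ⌊≟⌋-≢ (λ { refl → α≮0 (EY-tail y) })

  α-decomposition : ∀ i → + count mX (λ x → ⌊ xHead x ≟ i ⌋) ℤ.+
                          sumℤ mY (λ y → if ⌊ yTail y ≟ i ⌋ then α̂Y (yHead y) else + 0) ≡ α i
  α-decomposition i with ℤP.<-cmp (+ 0) (α i)
  ... | tri< 0<α _ _ = trans (cong₂ ℤ._+_ (EX-count i 0<α) (sumℤ-if-none mY _ (no-EY-tail (ℤP.<-asym 0<α))))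
                             (ℤP.+-identityʳ (α i))
  ... | tri≈ _ 0≡α _ = trans (cong₂ ℤ._+_ (cong +_ (count-none mX (no-EX-head (ℤP.<-irrefl 0≡α))))
                                          (sumℤ-if-none mY _ (no-EY-tail (ℤP.<-irrefl (sym 0≡α)))))
                             0≡α
  ... | tri> _ _ α<0 = trans (cong₂ ℤ._+_ (cong +_ (count-none mX (no-EX-head (ℤP.<-asym α<0))))
                                          (sym (α-split i α<0)))
                             (ℤP.+-identityˡ (α i))

  Pinned : Point (nE Ĝ) → Set
  Pinned F = (∀ x → F (eX x) ≡ 1ℚ) × (∀ y → F (eY y) ≡ ℚ.- ι (α̂Y (yHead y)))

  netflow-vV-pinned : ∀ {F} → Pinned F → ∀ i →
                      netflow Ĝ F (vV A i) ≡ netflow G (restrict A F) i ℚ.- ι (α i)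
  netflow-vV-pinned {F} (F-eX , F-eY) i = begin
    netflow Ĝ F (vV A i)                               ≡⟨ netflow-vV F i ⟩
    netflow G (restrict A F) i ℚ.+ (fromY ℚ.- intoX)   ≡⟨ cong (netflow G (restrict A F) i ℚ.+_) surplus ⟩
    netflow G (restrict A F) i ℚ.- ι (α i)             ∎
    where
    open ≡-Reasoning
    fromY = sumℚ mY (λ y → if ⌊ yTail y ≟ i ⌋ then F (eY y) else 0ℚ)
    intoX = sumℚ mX (λ x → if ⌊ xHead x ≟ i ⌋ then F (eX x) else 0ℚ)
    countX = + count mX (λ x → ⌊ xHead x ≟ i ⌋)
    sumY = sumℤ mY (λ y → if ⌊ yTail y ≟ i ⌋ then α̂Y (yHead y) else + 0)
    surplus : fromY ℚ.- intoX ≡ ℚ.- ι (α i)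
    surplus = begin
      fromY ℚ.- intoX
        ≡⟨ cong₂ ℚ._-_ (trans (sumℚ-if-congʳ mY _ F-eY) (sumℚ-if-neg-ι mY _ (α̂Y ∘ yHead)))
                       (trans (sumℚ-if-congʳ mX _ F-eX) (sumℚ-indicator mX _)) ⟩
      ℚ.- ι sumY ℚ.- ι countX
        ≡⟨ solve 2 (λ a b → :- a :- b := :- (b :+ a)) refl (ι sumY) (ι countX) ⟩
      ℚ.- (ι countX ℚ.+ ι sumY)
        ≡⟨ cong ℚ.-_ (trans (sym (ι-+ countX sumY)) (cong ι (α-decomposition i))) ⟩
      ℚ.- ι (α i) ∎

  extend : Point (nE G) → Point (nE Ĝ)
  extend y = E.case³ y (const 1ℚ) (λ k → ℚ.- ι (α̂Y (yHead k)))

  restrict-extend : ∀ y → restrict A (extend y) ≐ y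
  restrict-extend y = E.case³-in₁ y (const 1ℚ) (λ k → ℚ.- ι (α̂Y (yHead k)))

  extend-pinned : ∀ y → Pinned (extend y)
  extend-pinned y = E.case³-in₂ y (const 1ℚ) (λ k → ℚ.- ι (α̂Y (yHead k))) ,
                    E.case³-in₃ y (const 1ℚ) (λ k → ℚ.- ι (α̂Y (yHead k)))

  pinned-injective : ∀ {F F′} → Pinned F → Pinned F′ → restrict A F ≐ restrict A F′ → F ≐ F′
  pinned-injective (F-eX , F-eY) (F′-eX , F′-eY) F≐F′ = E.in-elim _ F≐F′
    (λ x → trans (F-eX x) (sym (F′-eX x)))
    (λ y → trans (F-eY y) (sym (F′-eY y)))

  private
    P̂ : Point (nE Ĝ) → Set
    P̂ = FlowPolytope Ĝ (augNet A)

  flow-pinned : ∀ {F} → P̂ F → Pinned F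
  flow-pinned {F} (_ , conserved) = F-eX , F-eY
    where
    F-eX : ∀ x → F (eX x) ≡ 1ℚ
    F-eX x = begin
      F (eX x)                                ≡⟨ netflow-source F x (xTail x) refl ⟨
      netflow Ĝ F (vX A (xTail x))            ≡⟨ conserved (vX A (xTail x)) ⟩
      ι (augNet A (vX A (xTail x)))           ≡⟨ cong ι (augNet-vX (xTail x)) ⟩
      1ℚ                                      ∎
      where open ≡-Reasoning
    F-eY : ∀ y → F (eY y) ≡ ℚ.- ι (α̂Y (yHead y))
    F-eY y = begin
      F (eY y)                                ≡⟨ ⁻¹-involutive (F (eY y)) ⟨
      ℚ.- (ℚ.- F (eY y))                      ≡⟨ cong ℚ.-_ (netflow-sink F y (yHead y) refl) ⟨
      ℚ.- netflow Ĝ F (vY A (yHead y))        ≡⟨ cong ℚ.-_ (conserved (vY A (yHead y))) ⟩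
      ℚ.- ι (augNet A (vY A (yHead y)))       ≡⟨ cong (ℚ.-_ ∘ ι) (augNet-vY (yHead y)) ⟩
      ℚ.- ι (α̂Y (yHead y))                    ∎
      where open ≡-Reasoning

  restrict-flow : ∀ {F} → P̂ F → FlowPolytope G α (restrict A F)
  restrict-flow {F} F∈P̂@(nonNeg , conserved) = nonNeg ∘ eE , λ i →
    x∙y⁻¹≈ε⇒x≈y _ _ (begin
      netflow G (restrict A F) i ℚ.- ι (α i)   ≡⟨ netflow-vV-pinned (flow-pinned F∈P̂) i ⟨
      netflow Ĝ F (vV A i)                     ≡⟨ conserved (vV A i) ⟩
      ι (augNet A (vV A i))                    ≡⟨ cong ι (augNet-vV i) ⟩
      0ℚ                                       ∎)
    where open ≡-Reasoning

  extend-flow : ∀ {y} → FlowPolytope G α y → P̂ (extend y)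
  extend-flow {y} (nonNeg , conserved) = extend-nonNeg , V.in-elim _ at-vV at-vX at-vY
    where
    open ≡-Reasoning
    extend-nonNeg : ∀ e → 0ℚ ℚ.≤ extend y e
    extend-nonNeg = E.in-elim _
      (λ e → subst (0ℚ ℚ.≤_) (sym (restrict-extend y e)) (nonNeg e))
      (λ x → subst (0ℚ ℚ.≤_) (sym (proj₁ (extend-pinned y) x)) (ℚP.nonNegative⁻¹ 1ℚ))
      (λ k → subst (0ℚ ℚ.≤_) (sym (proj₂ (extend-pinned y) k)) (neg-ι-nonNeg _ (α̂Y-neg (yHead k))))
    at-vV : ∀ i → netflow Ĝ (extend y) (vV A i) ≡ ι (augNet A (vV A i))
    at-vV i = begin
      netflow Ĝ (extend y) (vV A i)                     ≡⟨ netflow-vV-pinned (extend-pinned y) i ⟩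
      netflow G (restrict A (extend y)) i ℚ.- ι (α i)
        ≡⟨ cong (ℚ._- ι (α i)) (netflow-cong G (restrict-extend y) i) ⟩
      netflow G y i ℚ.- ι (α i)                         ≡⟨ cong (ℚ._- ι (α i)) (conserved i) ⟩
      ι (α i) ℚ.- ι (α i)                               ≡⟨ ℚP.+-inverseʳ (ι (α i)) ⟩
      0ℚ                                                ≡⟨ cong ι (augNet-vV i) ⟨
      ι (augNet A (vV A i))                             ∎
    at-vX : ∀ v → netflow Ĝ (extend y) (vX A v) ≡ ι (augNet A (vX A v))
    at-vX v with x , xTail≡v ← count-fiber-witness mX xTail v (VX-inc v) = begin
      netflow Ĝ (extend y) (vX A v)     ≡⟨ netflow-source (extend y) x v xTail≡v ⟩
      extend y (eX x)                   ≡⟨ proj₁ (extend-pinned y) x ⟩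
      1ℚ                                ≡⟨ cong ι (augNet-vX v) ⟨
      ι (augNet A (vX A v))             ∎
    at-vY : ∀ v → netflow Ĝ (extend y) (vY A v) ≡ ι (augNet A (vY A v))
    at-vY v with k , yHead≡v ← count-fiber-witness mY yHead v (VY-inc v) = begin
      netflow Ĝ (extend y) (vY A v)     ≡⟨ netflow-sink (extend y) k v yHead≡v ⟩
      ℚ.- extend y (eY k)               ≡⟨ cong ℚ.-_ (proj₂ (extend-pinned y) k) ⟩
      ℚ.- (ℚ.- ι (α̂Y (yHead k)))        ≡⟨ ⁻¹-involutive (ι (α̂Y (yHead k))) ⟩
      ι (α̂Y (yHead k))                  ≡⟨ cong ι (trans (cong α̂Y yHead≡v) (sym (augNet-vY v))) ⟩
      ι (augNet A (vY A v))             ∎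

  extend-integral : ∀ {y} → IsIntegral y → IsIntegral (extend y)
  extend-integral {y} y-integral = E.in-elim _
    (λ e → let z , ye≡z = y-integral e in z , trans (restrict-extend y e) ye≡z)
    (λ x → + 1 , proj₁ (extend-pinned y) x)
    (λ k → ℤ.- α̂Y (yHead k) , trans (proj₂ (extend-pinned y) k) (sym (ι-neg (α̂Y (yHead k)))))

  extend-preservesAffineCombinations : PreservesAffineCombinations extend
  extend-preservesAffineCombinations cs y Σc≡1 y≐combo = E.in-elim _
    (λ e → trans (restrict-extend y e)
             (trans (y≐combo e) (sym (combo-mapPoints extend cs (eE e) e (λ z → restrict-extend z e)))))
    (λ x → trans (proj₁ (extend-pinned y) x)
             (sym (mapPoints-affineCombo-const extend cs (eX x) _ Σc≡1 (λ z → proj₁ (extend-pinned z) x))))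
    (λ k → trans (proj₂ (extend-pinned y) k)
             (sym (mapPoints-affineCombo-const extend cs (eY k) _ Σc≡1 (λ z → proj₂ (extend-pinned z) k))))

  affineHull-pinned : ∀ {F} → InAff P̂ F → Pinned F
  affineHull-pinned F∈aff =
    (λ x → InAff-const (eX x) _ (λ _ F∈P̂ → proj₁ (flow-pinned F∈P̂) x) F∈aff) ,
    (λ y → InAff-const (eY y) _ (λ _ F∈P̂ → proj₂ (flow-pinned F∈P̂) y) F∈aff)

  restrict-isAffine : IsAffine (restrict A)
  restrict-isAffine = reindex-isAffine eE

  restrict-bijOn-flows : BijOn (restrict A) P̂ (FlowPolytope G α)
  restrict-bijOn-flows =
    (λ _ → restrict-flow) ,
    (λ _ _ F∈P̂ F′∈P̂ → pinned-injective (flow-pinned F∈P̂) (flow-pinned F′∈P̂)) ,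
    (λ y y∈P → extend y , extend-flow y∈P , restrict-extend y)

  restrict-bijOn-lattice : BijOn (restrict A) (λ F → IsIntegral F × InAff P̂ F)
                                              (λ y → IsIntegral y × InAff (FlowPolytope G α) y)
  restrict-bijOn-lattice =
    (λ F (F-integral , F∈aff) →
       F-integral ∘ eE ,
       InAff-image (restrict A) (λ _ → restrict-flow) (reindex-preservesAffineCombinations eE) F∈aff) ,
    (λ _ _ (_ , F∈aff) (_ , F′∈aff) →
       pinned-injective (affineHull-pinned F∈aff) (affineHull-pinned F′∈aff)) ,
    (λ y (y-integral , y∈aff) →
       extend y ,
       (extend-integral y-integral ,
        InAff-image extend (λ _ → extend-flow) extend-preservesAffineCombinations y∈aff) ,
       restrict-extend y)

lemma4p2 : (G : Graph) → IsDAG G → (α : Fin (nV G) → ℤ) → (A : Augmentation G α) →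
    IntegralEquivalence (restrict A) (FlowPolytope (augGraph A) (augNet A)) (FlowPolytope G α)
lemma4p2 G _ α A = restrict-isAffine A , restrict-bijOn-flows A , restrict-bijOn-lattice A
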